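{- Let $G=(V,E)$ be a finite connected undirected graph and $q\in V$. Let $g$ be a $G$-parking function with respect to $q$ which is not maximum, and let $F_g$ be the set of maximum $G$-parking functions $f$ with respect to $q$ such that $g\prec f$. Then $g=\bigwedge_{f\in F_g}f$, i.e. $g(v)=\min_{f\in F_g}f(v)$ for every $v\in V$.
   Context: For $A\subseteq V$ and $v\in A$, $d_{\overline{A}}(v)$ denotes the number of edges $vw$ with $w\notin A$. A $G$-parking function with respect to $q$ is $f:V\to\mathbb{Z}_{\geq -1}$ with $f(q)=-1$ such that for every non-empty $A\subseteq V\setminus\{q\}$ there is $v\in A$ with $0\leq f(v)<d_{\overline{A}}(v)$. A maximum parking function is one maximizing $\sum_v f(v)$. $g\prec f$ means $g(v)\le f(v)$ for all $v\in V$, and $f\wedge g$ is the pointwise minimum. -}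

module Defs where

open import Data.Nat using (ℕ; zero; suc)
open import Data.Bool using (Bool; true; false; if_then_else_; _∧_; not)
open import Data.Fin using (Fin)
open import Data.Fin.Subset using (Subset; _∈_; _∉_; Nonempty)
open import Data.Vec using (lookup; tabulate)
import Data.Vec as Vec
open import Data.Integer using (ℤ; +_; -1ℤ; _≤_; _<_; _+_; 0ℤ)
open import Data.Product using (Σ; ∃; _×_; _,_)
open import Relation.Binary.PropositionalEquality using (_≡_)
open import Relation.Nullary using (¬_)

record Graph (n : ℕ) : Set where
  field
    adj   : Fin n → Fin n → Bool
    sym   : ∀ u v → adj u v ≡ adj v u
    irref : ∀ v → adj v v ≡ false
open Graph public

data Walk {n : ℕ} (G : Graph n) : Fin n → Fin n → Set where
  here : ∀ {v} → Walk G v v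
  step : ∀ {u w v} → adj G u w ≡ true → Walk G w v → Walk G u v

Connected : ∀ {n} → Graph n → Set
Connected G = ∀ u v → Walk G u v

dOut : ∀ {n} → Graph n → Subset n → Fin n → ℕ
dOut {n} G A v =
  Vec.sum (tabulate λ w → if adj G v w ∧ not (lookup A w) then 1 else 0)

IsParking : ∀ {n} → Graph n → Fin n → (Fin n → ℤ) → Set
IsParking {n} G q f =
  (∀ v → -1ℤ ≤ f v) ×
  (f q ≡ -1ℤ) ×
  (∀ (A : Subset n) → Nonempty A → q ∉ A →
     ∃ λ v → v ∈ A × (0ℤ ≤ f v) × (f v < + dOut G A v))

total : ∀ {n} → (Fin n → ℤ) → ℤ
total {n} f = Vec.foldr _ _+_ 0ℤ (tabulate f)

IsMaximumParking : ∀ {n} → Graph n → Fin n → (Fin n → ℤ) → Set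
IsMaximumParking {n} G q f =
  IsParking G q f × (∀ (h : Fin n → ℤ) → IsParking G q h → total h ≤ total f)

_≼_ : ∀ {n} → (Fin n → ℤ) → (Fin n → ℤ) → Set
g ≼ f = ∀ v → g v ≤ f v

InF : ∀ {n} → Graph n → Fin n → (Fin n → ℤ) → (Fin n → ℤ) → Set
InF G q g f = IsMaximumParking G q f × (g ≼ f)

IsMinOverF : ∀ {n} → Graph n → Fin n → (Fin n → ℤ) → Fin n → ℤ → Set
IsMinOverF {n} G q g v x =
  (∃ λ (f : Fin n → ℤ) → InF G q g f × (f v ≡ x)) ×
  (∀ (f : Fin n → ℤ) → InF G q g f → x ≤ f v)

-- Every ordering of the vertices that starts at q induces f(w) = (number of
-- neighbours of w placed before w) − 1.  Such an f is a parking function (in a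
-- set A avoiding q, its earliest vertex has all earlier neighbours outside A),
-- and its total is |E| − |V| whatever the ordering, since every edge is counted
-- once, at its later endpoint.  Dhar's burning algorithm turns a parking
-- function g into an ordering with g(w) < #earlier neighbours for all w: burn q,
-- then repeatedly a vertex with more than g(w) burnt neighbours, which exists by
-- the parking condition applied to the unburnt set.  So g is dominated by an
-- induced f, and the induced functions are exactly of maximum total.  Burning v
-- as soon as it becomes eligible gives it exactly g(v) + 1 earlier neighbours,
-- i.e. f(v) = g(v).
module Submission where

open import Algebra.Properties.CommutativeMonoid.Sum as Sum using ()
open import Data.Bool using (Bool; true; false; if_then_else_; _∧_; not)
open import Data.Bool.Properties using (∧-zeroʳ)
open import Data.Empty using (⊥; ⊥-elim)
open import Data.Fin using (Fin; zero; suc; _≟_; punchIn)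
open import Data.Fin.Properties using (any?; punchInᵢ≢i)
open import Data.Fin.Subset using (Subset; _∈_; _∉_; _⊂_; Nonempty; ∣_∣; ⁅_⁆)
open import Data.Fin.Subset.Properties
  using (_∈?_; nonempty?; ∣p∣≤n; p⊂q⇒∣p∣<∣q∣; x∈⁅x⁆; x∈⁅y⁆⇒x≡y)
open import Data.Integer as ℤ using (ℤ; +_; -1ℤ; 0ℤ; 1ℤ; pred; +<+; +≤+; -<+)
import Data.Integer.Properties as ℤₚ
open import Data.Integer.Tactic.RingSolver using (solve-∀)
open import Data.Nat using (ℕ; zero; suc; _+_; _*_; _≤_; _<_; z≤n; s≤s; s≤s⁻¹; _≤?_; _<?_)
open import Data.Nat.Properties
  using ( +-0-commutativeMonoid; ≤-refl; ≤-reflexive; ≤-trans; ≤-antisym; <-irrefl; <-asym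
        ; <-≤-trans; <⇒≤; <⇒≱; ≰⇒>; ≮⇒≥; n≤1+n; n<1+n; 1+n≢n; n≮0; m≤n+m
        ; +-mono-≤; +-monoʳ-≤; +-monoˡ-≤; +-identityʳ; *-cancelˡ-≡; module ≤-Reasoning)
  renaming (_≟_ to _≟ℕ_)
open import Data.Product using (∃; _×_; _,_; proj₁; proj₂)
open import Data.Vec using (tabulate; lookup)
import Data.Vec as Vec
open import Data.Vec.Functional using (removeAt)
open import Data.Vec.Properties using (lookup∘tabulate; []=⇒lookup; lookup⇒[]=)
open import Function using (_∘_; _⇔_; mk⇔)
open import Function.Definitions using (Injective)
open import Relation.Binary.PropositionalEquality
open import Relation.Nullary using (¬_; Dec; yes; no; does; ¬?)
open import Relation.Nullary.Decidable using (_×-dec_; does-⇔; dec-true; dec-false)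

open import Defs renaming (sym to adj-sym)

open Sum +-0-commutativeMonoid
  using (sum; sum-syntax; sum-cong-≗; ∑-distrib-+; ∑-comm; sum-remove; sum-replicate-zero)

sum-tabulate : ∀ {n} (f : Fin n → ℕ) → Vec.sum (tabulate f) ≡ sum f
sum-tabulate {zero}  f = refl
sum-tabulate {suc n} f = cong (_+_ (f zero)) (sum-tabulate (f ∘ suc))

sum-mono-≤ : ∀ {n} {f g : Fin n → ℕ} → (∀ u → f u ≤ g u) → sum f ≤ sum g
sum-mono-≤ {zero}  f≤g = z≤n
sum-mono-≤ {suc n} f≤g = +-mono-≤ (f≤g zero) (sum-mono-≤ (f≤g ∘ suc))

sum-mono-≤-except : ∀ {n} {f g : Fin n → ℕ} (w : Fin n) →
  (∀ u → u ≢ w → f u ≤ g u) → sum f ≤ f w + sum g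
sum-mono-≤-except {suc n} {f} {g} w f≤g = begin
  sum f                             ≡⟨ sum-remove {i = w} f ⟩
  f w + sum (removeAt f w)          ≤⟨ +-monoʳ-≤ (f w) (sum-mono-≤ off-w) ⟩
  f w + sum (removeAt g w)          ≤⟨ +-monoʳ-≤ (f w) (m≤n+m _ (g w)) ⟩
  f w + (g w + sum (removeAt g w))  ≡⟨ cong (_+_ (f w)) (sum-remove {i = w} g) ⟨
  f w + sum g                       ∎
  where
  open ≤-Reasoning
  off-w : ∀ u → removeAt f w u ≤ removeAt g w u
  off-w u = f≤g (punchIn w u) (punchInᵢ≢i w u)

does≡true⇒ : ∀ {A : Set} (A? : Dec A) → does A? ≡ true → A
does≡true⇒ (yes a) _ = a

indicator : Bool → ℕ
indicator b = if b then 1 else 0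

indicator≤1 : ∀ b → indicator b ≤ 1
indicator≤1 true  = ≤-refl
indicator≤1 false = z≤n

indicator-∧-mono : ∀ a {A : Set} (A? : Dec A) {c} → (A → c ≡ true) →
  indicator (a ∧ does A?) ≤ indicator (a ∧ c)
indicator-∧-mono false _       _   = z≤n
indicator-∧-mono true  (no _)  _   = z≤n
indicator-∧-mono true  (yes x) A⇒c rewrite A⇒c x = ≤-refl

indicator-∧-split : ∀ a {A B : Set} (A? : Dec A) (B? : Dec B) →
  (A → ¬ B) → (a ≡ true → ¬ A → ¬ B → ⊥) →
  indicator (a ∧ does A?) + indicator (a ∧ does B?) ≡ indicator a
indicator-∧-split false _       _       _       _    = refl
indicator-∧-split true  (yes x) (yes y) A⇒¬B    _    = ⊥-elim (A⇒¬B x y)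
indicator-∧-split true  (yes _) (no _)  _       _    = refl
indicator-∧-split true  (no _)  (yes _) _       _    = refl
indicator-∧-split true  (no ¬x) (no ¬y) _       some = ⊥-elim (some refl ¬x ¬y)

not-lookup-∉ : ∀ {n} {S : Subset n} {u} → u ∉ S → not (lookup S u) ≡ true
not-lookup-∉ {S = S} {u} u∉S with lookup S u in e
... | true  = ⊥-elim (u∉S (lookup⇒[]= u S e))
... | false = refl

nonempty⇒∃-minimal : ∀ {n} (S : Subset n) (p : Fin n → ℕ) → Nonempty S →
  ∃ λ m → m ∈ S × (∀ {u} → u ∈ S → ¬ p u < p m)
nonempty⇒∃-minimal S p (w , w∈S) = descend (suc (p w)) w w∈S ≤-refl
  where
  descend : ∀ b w → w ∈ S → p w < b → ∃ λ m → m ∈ S × (∀ {u} → u ∈ S → ¬ p u < p m)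
  descend (suc b) w w∈S pw<b with any? (λ u → (u ∈? S) ×-dec (p u <? p w))
  ... | yes (u , u∈S , pu<pw) = descend b u u∈S (<-≤-trans pu<pw (s≤s⁻¹ pw<b))
  ... | no none               = w , w∈S , λ u∈S pu<pw → none (_ , u∈S , pu<pw)

total-mono : ∀ {n} {f h : Fin n → ℤ} → f ≼ h → total f ℤ.≤ total h
total-mono {zero}  f≤h = ℤₚ.≤-refl
total-mono {suc n} f≤h = ℤₚ.+-mono-≤ (f≤h zero) (total-mono (f≤h ∘ suc))

total-pred : ∀ {n} (a : Fin n → ℕ) → total (λ w → pred (+ a w)) ≡ + sum a ℤ.- + n
total-pred {zero}  a = refl
total-pred {suc n} a = trans (cong (ℤ._+_ (pred (+ a zero))) (total-pred (a ∘ suc)))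
  (regroup (+ a zero) (+ sum (a ∘ suc)) (+ n))
  where
  regroup : ∀ x y z → (-1ℤ ℤ.+ x) ℤ.+ (y ℤ.- z) ≡ (x ℤ.+ y) ℤ.- (1ℤ ℤ.+ z)
  regroup = solve-∀

parking-nonneg : ∀ {n} (G : Graph n) q g → IsParking G q g → ∀ {w} → w ≢ q → 0ℤ ℤ.≤ g w
parking-nonneg G q g (_ , _ , burnable) {w} w≢q
  with burnable ⁅ w ⁆ (w , x∈⁅x⁆ w) (w≢q ∘ sym ∘ x∈⁅y⁆⇒x≡y w)
... | u , u∈⁅w⁆ , 0≤gu , _ with x∈⁅y⁆⇒x≡y w u∈⁅w⁆
...   | refl = 0≤gu

-- Orderings of the vertices are encoded by injective rank functions Fin n → ℕ.
module _ {n : ℕ} (G : Graph n) where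

  backDegree : (Fin n → ℕ) → Fin n → ℕ
  backDegree p w = ∑[ u < n ] indicator (adj G w u ∧ does (p u <? p w))

  forwardDegree : (Fin n → ℕ) → Fin n → ℕ
  forwardDegree p w = ∑[ u < n ] indicator (adj G w u ∧ does (p w <? p u))

  degree : Fin n → ℕ
  degree w = ∑[ u < n ] indicator (adj G w u)

  backDegree-cong : ∀ {p p′ x} → (∀ u → p′ u < p′ x ⇔ p u < p x) →
    backDegree p′ x ≡ backDegree p x
  backDegree-cong {p} {p′} {x} same = sum-cong-≗ λ u →
    cong (λ b → indicator (adj G x u ∧ b)) (does-⇔ (same u) (p′ u <? p′ x) (p u <? p x))

  backDegree-≤-except : ∀ {p p′ x} w → (∀ u → u ≢ w → p′ u < p′ x → p u < p x) →
    backDegree p′ x ≤ 1 + backDegree p x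
  backDegree-≤-except {p} {p′} {x} w gained = ≤-trans
    (sum-mono-≤-except w λ u u≢w →
      indicator-∧-mono (adj G x u) (p′ u <? p′ x) (dec-true (p u <? p x) ∘ gained u u≢w))
    (+-monoˡ-≤ _ (indicator≤1 _))

  backDegree-zero : ∀ {p w} → p w ≡ 0 → backDegree p w ≡ 0
  backDegree-zero {p} {w} pw≡0 = trans (sum-cong-≗ none-below) (sum-replicate-zero n)
    where
    none-below : ∀ u → indicator (adj G w u ∧ does (p u <? p w)) ≡ 0
    none-below u = cong indicator (trans
      (cong (adj G w u ∧_) (dec-false (p u <? p w) (n≮0 ∘ subst (p u <_) pw≡0)))
      (∧-zeroʳ (adj G w u)))

  split-edge : ∀ {p} → Injective _≡_ _≡_ p → ∀ w u →
    indicator (adj G w u ∧ does (p u <? p w)) + indicator (adj G w u ∧ does (p w <? p u))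
      ≡ indicator (adj G w u)
  split-edge {p} inj w u = indicator-∧-split (adj G w u) (p u <? p w) (p w <? p u) <-asym tie
    where
    tie : adj G w u ≡ true → ¬ p u < p w → ¬ p w < p u → ⊥
    tie wu u≮w w≮u with inj (≤-antisym (≮⇒≥ w≮u) (≮⇒≥ u≮w))
    ... | refl with trans (sym wu) (irref G w)
    ...   | ()

  backDegree+forwardDegree≡degree : ∀ {p} → Injective _≡_ _≡_ p → ∀ w →
    backDegree p w + forwardDegree p w ≡ degree w
  backDegree+forwardDegree≡degree {p} inj w = trans
    (sym (∑-distrib-+ (λ u → indicator (adj G w u ∧ does (p u <? p w)))
                      (λ u → indicator (adj G w u ∧ does (p w <? p u)))))
    (sum-cong-≗ (split-edge inj w))

  ∑forwardDegree≡∑backDegree : ∀ p → sum (forwardDegree p) ≡ sum (backDegree p)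
  ∑forwardDegree≡∑backDegree p =
    trans (∑-comm (λ w u → indicator (adj G w u ∧ does (p w <? p u))))
          (sum-cong-≗ λ u → sum-cong-≗ λ w →
            cong (λ b → indicator (b ∧ does (p w <? p u))) (adj-sym G w u))

  2*∑backDegree≡∑degree : ∀ {p} → Injective _≡_ _≡_ p → 2 * sum (backDegree p) ≡ sum degree
  2*∑backDegree≡∑degree {p} inj = begin
    2 * B                                           ≡⟨ cong (_+_ B) (+-identityʳ B) ⟩
    B + B                                           ≡⟨ cong (_+_ B) (∑forwardDegree≡∑backDegree p) ⟨
    B + sum (forwardDegree p)                       ≡⟨ ∑-distrib-+ (backDegree p) (forwardDegree p) ⟨
    sum (λ w → backDegree p w + forwardDegree p w)  ≡⟨ sum-cong-≗ (backDegree+forwardDegree≡degree inj) ⟩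
    sum degree                                      ∎
    where
    open ≡-Reasoning
    B = sum (backDegree p)

  ∑backDegree-invariant : ∀ {p τ} → Injective _≡_ _≡_ p → Injective _≡_ _≡_ τ →
    sum (backDegree p) ≡ sum (backDegree τ)
  ∑backDegree-invariant p-inj τ-inj =
    *-cancelˡ-≡ _ _ 2
      (trans (2*∑backDegree≡∑degree p-inj) (sym (2*∑backDegree≡∑degree τ-inj)))

  inducedParking : (Fin n → ℕ) → Fin n → ℤ
  inducedParking p w = pred (+ backDegree p w)

  ≼-inducedParking : ∀ {p} {h : Fin n → ℤ} → (∀ w → h w ℤ.< + backDegree p w) →
    h ≼ inducedParking p
  ≼-inducedParking below w = ℤₚ.i<j⇒i≤pred[j] (below w)

  inducedParking-isParking : ∀ {q p} → p q ≡ 0 → (∀ w → w ≢ q → 0 < backDegree p w) →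
    IsParking G q (inducedParking p)
  inducedParking-isParking {q} {p} pq≡0 back>0 =
    (λ w → ℤₚ.pred-mono (+≤+ (z≤n {backDegree p w}))) ,
    cong (pred ∘ +_) (backDegree-zero {p} {q} pq≡0) ,
    burnable
    where
    burnable : ∀ S → Nonempty S → q ∉ S →
      ∃ λ w → w ∈ S × 0ℤ ℤ.≤ inducedParking p w × inducedParking p w ℤ.< + dOut G S w
    burnable S ne q∉S with nonempty⇒∃-minimal S p ne
    ... | m , m∈S , minimal =
      m , m∈S , ℤₚ.i<j⇒i≤pred[j] (+<+ (back>0 m m≢q)) ,
      ℤₚ.i≤pred[j]⇒i<j (ℤₚ.pred-mono (+≤+ back≤dOut))
      where
      m≢q : m ≢ q
      m≢q refl = q∉S m∈S
      back≤dOut : backDegree p m ≤ dOut G S m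
      back≤dOut = subst (backDegree p m ≤_)
        (sym (sum-tabulate (λ u → indicator (adj G m u ∧ not (lookup S u)))))
        (sum-mono-≤ λ u → indicator-∧-mono (adj G m u) (p u <? p m) λ pu<pm →
          not-lookup-∉ (λ u∈S → minimal u∈S pu<pm))

record BurningOrder {n} (G : Graph n) (q : Fin n) (g : Fin n → ℤ) (p : Fin n → ℕ) : Set where
  field
    injective : Injective _≡_ _≡_ p
    root      : p q ≡ 0
    fits      : ∀ w → g w ℤ.< + backDegree G p w

module Burning {n} (G : Graph n) (q : Fin n) (g : Fin n → ℤ) (g-parking : IsParking G q g)
  (v : Fin n) where

  -- At stage k the vertices of rank < k are burnt, in the order of their ranks;
  -- all others have rank k.
  record Partial (k : ℕ) (p : Fin n → ℕ) : Set where
    field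
      bounded        : ∀ u → p u ≤ k
      root           : p q ≡ 0
      injective      : ∀ {u u′} → p u < k → p u ≡ p u′ → u ≡ u′
      fits           : ∀ {w} → p w < k → g w ℤ.< + backDegree G p w
      target-burnt   : p v < k → + backDegree G p v ≡ ℤ.suc (g v)
      target-waiting : p v ≡ k → + backDegree G p v ℤ.≤ ℤ.suc (g v)

  unburnt : ℕ → (Fin n → ℕ) → Subset n
  unburnt k p = tabulate (λ u → does (k ≤? p u))

  ∈-unburnt⁺ : ∀ {k p u} → k ≤ p u → u ∈ unburnt k p
  ∈-unburnt⁺ {k} {p} {u} k≤pu =
    lookup⇒[]= u _ (trans (lookup∘tabulate _ u) (dec-true (k ≤? p u) k≤pu))

  ∈-unburnt⁻ : ∀ {k p u} → u ∈ unburnt k p → k ≤ p u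
  ∈-unburnt⁻ {k} {p} {u} u∈ =
    does≡true⇒ (k ≤? p u) (trans (sym (lookup∘tabulate _ u)) ([]=⇒lookup u∈))

  dOut-unburnt : ∀ {k p w} → p w ≡ k → dOut G (unburnt k p) w ≡ backDegree G p w
  dOut-unburnt {k} {p} {w} pw≡k =
    trans (sum-tabulate (λ u → indicator (adj G w u ∧ not (lookup (unburnt k p) u))))
          (sum-cong-≗ λ u → cong (λ b → indicator (adj G w u ∧ b)) (outside≡burnt u))
    where
    burnt⇔ : ∀ u → (¬ k ≤ p u) ⇔ p u < p w
    burnt⇔ u = mk⇔ (subst (p u <_) (sym pw≡k) ∘ ≰⇒>) (<⇒≱ ∘ subst (p u <_) pw≡k)
    outside≡burnt : ∀ u → not (lookup (unburnt k p) u) ≡ does (p u <? p w)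
    outside≡burnt u = trans (cong not (lookup∘tabulate (λ u → does (k ≤? p u)) u))
                            (does-⇔ (burnt⇔ u) (¬? (k ≤? p u)) (p u <? p w))

  start : Partial 0 (λ _ → 0)
  start = record
    { bounded        = λ _ → z≤n
    ; root           = refl
    ; injective      = λ ()
    ; fits           = λ ()
    ; target-burnt   = λ ()
    ; target-waiting = λ _ → subst (λ b → + b ℤ.≤ ℤ.suc (g v)) (sym (backDegree-zero G refl))
                                   (ℤₚ.+-monoʳ-≤ 1ℤ (proj₁ g-parking v))
    }

  module Step {k p} (st : Partial k p) {w : Fin n} (w-waiting : p w ≡ k)
      (w-fits : g w ℤ.< + backDegree G p w)
      (v-first : w ≢ v → p v ≡ k → ¬ g v ℤ.< + backDegree G p v) where
    open Partial st

    rank : ∀ {u} → Dec (p u < k) → Dec (u ≡ w) → ℕ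
    rank {u} (yes _) _ = p u
    rank (no _) (yes _) = k
    rank (no _) (no _)  = suc k

    p′ : Fin n → ℕ
    p′ u = rank (p u <? k) (u ≟ w)

    data View (u : Fin n) (r : ℕ) : Set where
      burnt   : p u < k → r ≡ p u → View u r
      chosen  : u ≡ w → r ≡ k → View u r
      waiting : u ≢ w → p u ≡ k → r ≡ suc k → View u r

    view : ∀ u → View u (p′ u)
    view u = view′ (p u <? k) (u ≟ w)
      where
      view′ : (burnt? : Dec (p u < k)) (chosen? : Dec (u ≡ w)) → View u (rank burnt? chosen?)
      view′ (yes pu<k) _         = burnt pu<k refl
      view′ (no _)     (yes u≡w) = chosen u≡w refl
      view′ (no pu≮k)  (no u≢w)  = waiting u≢w (≤-antisym (bounded u) (≮⇒≥ pu≮k)) refl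

    burnt-rank : ∀ {u} → p u < k → p′ u ≡ p u
    burnt-rank {u} pu<k with view u
    ... | burnt _ e          = e
    ... | chosen refl _      = ⊥-elim (<-irrefl w-waiting pu<k)
    ... | waiting _ pu≡k _   = ⊥-elim (<-irrefl pu≡k pu<k)

    chosen-rank : p′ w ≡ k
    chosen-rank with view w
    ... | burnt pw<k _      = ⊥-elim (<-irrefl w-waiting pw<k)
    ... | chosen _ e        = e
    ... | waiting w≢w _ _   = ⊥-elim (w≢w refl)

    waiting-rank : ∀ {u} → u ≢ w → p u ≡ k → p′ u ≡ suc k
    waiting-rank {u} u≢w pu≡k with view u
    ... | burnt pu<k _    = ⊥-elim (<-irrefl pu≡k pu<k)
    ... | chosen u≡w _    = ⊥-elim (u≢w u≡w)
    ... | waiting _ _ e   = e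

    backDegree-kept : ∀ {x} → p x ≤ k → p′ x ≡ p x → backDegree G p′ x ≡ backDegree G p x
    backDegree-kept {x} px≤k same = backDegree-cong G λ u → mk⇔ (to u) (from u)
      where
      to : ∀ u → p′ u < p′ x → p u < p x
      to u lt with view u
      ... | burnt _ e     = subst₂ _<_ e same lt
      ... | chosen _ e    = ⊥-elim (<⇒≱ (subst₂ _<_ e same lt) px≤k)
      ... | waiting _ _ e = ⊥-elim (<⇒≱ (subst₂ _<_ e same lt) (≤-trans px≤k (n≤1+n k)))
      from : ∀ u → p u < p x → p′ u < p′ x
      from u lt with view u
      ... | burnt _ e        = subst₂ _<_ (sym e) (sym same) lt
      ... | chosen refl _    = ⊥-elim (<⇒≱ (subst (_< p x) w-waiting lt) px≤k)
      ... | waiting _ pu≡k _ = ⊥-elim (<⇒≱ (subst (_< p x) pu≡k lt) px≤k)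

    burnt-backDegree : ∀ {x} → p x < k → backDegree G p′ x ≡ backDegree G p x
    burnt-backDegree px<k = backDegree-kept (<⇒≤ px<k) (burnt-rank px<k)

    chosen-backDegree : backDegree G p′ w ≡ backDegree G p w
    chosen-backDegree = backDegree-kept (≤-reflexive w-waiting) (trans chosen-rank (sym w-waiting))

    waiting-backDegree : ∀ {x} → x ≢ w → p x ≡ k → backDegree G p′ x ≤ 1 + backDegree G p x
    waiting-backDegree {x} x≢w px≡k = backDegree-≤-except G w gained
      where
      gained : ∀ u → u ≢ w → p′ u < p′ x → p u < p x
      gained u u≢w lt with view u
      ... | burnt pu<k _  = subst (p u <_) (sym px≡k) pu<k
      ... | chosen u≡w _  = ⊥-elim (u≢w u≡w)
      ... | waiting _ _ e = ⊥-elim (<-irrefl (trans e (sym (waiting-rank x≢w px≡k))) lt)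

    -- Nothing is burnt at stage 0, so only q (where g q = -1) can be eligible then.
    first-burnt-is-root : k ≡ 0 → w ≡ q
    first-burnt-is-root k≡0 with w ≟ q
    ... | yes w≡q = w≡q
    ... | no  w≢q = ⊥-elim (ℤₚ.<⇒≱ gw<0 (parking-nonneg G q g g-parking w≢q))
      where
      gw<0 : g w ℤ.< 0ℤ
      gw<0 = subst (λ b → g w ℤ.< + b) (backDegree-zero G {p} {w} (trans w-waiting k≡0)) w-fits

    unburnt-shrinks : unburnt (suc k) p′ ⊂ unburnt k p
    unburnt-shrinks = still-unburnt , w , ∈-unburnt⁺ (≤-reflexive (sym w-waiting)) ,
                      λ w∈ → <-irrefl (sym chosen-rank) (∈-unburnt⁻ {suc k} {p′} w∈)
      where
      still-unburnt : ∀ {u} → u ∈ unburnt (suc k) p′ → u ∈ unburnt k p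
      still-unburnt {u} u∈ with view u | ∈-unburnt⁻ {suc k} {p′} u∈
      ... | burnt pu<k e     | sk≤p′u = ⊥-elim (<⇒≱ pu<k (≤-trans (n≤1+n k) (subst (suc k ≤_) e sk≤p′u)))
      ... | chosen _ e       | sk≤p′u = ⊥-elim (<⇒≱ (n<1+n k) (subst (suc k ≤_) e sk≤p′u))
      ... | waiting _ pu≡k _ | _      = ∈-unburnt⁺ (≤-reflexive (sym pu≡k))

    partial′ : Partial (suc k) p′
    partial′ = record
      { bounded = bounded′ ; root = root′ ; injective = injective′ ; fits = fits′
      ; target-burnt = target-burnt′ ; target-waiting = target-waiting′ }
      where
      bounded′ : ∀ u → p′ u ≤ suc k
      bounded′ u with view u
      ... | burnt pu<k e  = subst (_≤ suc k) (sym e) (≤-trans (<⇒≤ pu<k) (n≤1+n k))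
      ... | chosen _ e    = subst (_≤ suc k) (sym e) (n≤1+n k)
      ... | waiting _ _ e = ≤-reflexive e

      root′ : p′ q ≡ 0
      root′ with view q
      ... | burnt _ e          = trans e root
      ... | chosen refl e      = trans e (trans (sym w-waiting) root)
      ... | waiting q≢w pq≡k _ = ⊥-elim (q≢w (sym (first-burnt-is-root (trans (sym pq≡k) root))))

      injective′ : ∀ {u u′} → p′ u < suc k → p′ u ≡ p′ u′ → u ≡ u′
      injective′ {u} {u′} lt eq with view u | view u′
      ... | waiting _ _ e | _             = ⊥-elim (<-irrefl e lt)
      ... | burnt pu<k e  | burnt _ e′    = injective pu<k (trans (sym e) (trans eq e′))
      ... | burnt pu<k e  | chosen _ e′   = ⊥-elim (<-irrefl (trans (sym e) (trans eq e′)) pu<k)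
      ... | burnt pu<k e  | waiting _ _ e′ =
        ⊥-elim (<⇒≱ (subst (_< k) (trans (sym e) (trans eq e′)) pu<k) (n≤1+n k))
      ... | chosen _ e    | burnt pu′<k e′ =
        ⊥-elim (<-irrefl (trans (sym e′) (trans (sym eq) e)) pu′<k)
      ... | chosen u≡w _  | chosen u′≡w _  = trans u≡w (sym u′≡w)
      ... | chosen _ e    | waiting _ _ e′ = ⊥-elim (1+n≢n (trans (sym e′) (trans (sym eq) e)))

      fits′ : ∀ {x} → p′ x < suc k → g x ℤ.< + backDegree G p′ x
      fits′ {x} lt with view x
      ... | burnt px<k _  = subst (λ b → g x ℤ.< + b) (sym (burnt-backDegree px<k)) (fits px<k)
      ... | chosen refl _ = subst (λ b → g x ℤ.< + b) (sym chosen-backDegree) w-fits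
      ... | waiting _ _ e = ⊥-elim (<-irrefl e lt)

      target-burnt′ : p′ v < suc k → + backDegree G p′ v ≡ ℤ.suc (g v)
      target-burnt′ lt with view v
      ... | burnt pv<k _  = trans (cong +_ (burnt-backDegree pv<k)) (target-burnt pv<k)
      ... | chosen refl _ = trans (cong +_ chosen-backDegree)
                                  (ℤₚ.≤-antisym (target-waiting w-waiting) (ℤₚ.i<j⇒suc[i]≤j w-fits))
      ... | waiting _ _ e = ⊥-elim (<-irrefl e lt)

      target-waiting′ : p′ v ≡ suc k → + backDegree G p′ v ℤ.≤ ℤ.suc (g v)
      target-waiting′ eq with view v
      ... | burnt pv<k e       = ⊥-elim (<⇒≱ (subst (_< k) (trans (sym e) eq) pv<k) (n≤1+n k))
      ... | chosen _ e         = ⊥-elim (1+n≢n (trans (sym eq) e))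
      ... | waiting v≢w pv≡k _ = ℤₚ.≤-trans (+≤+ (waiting-backDegree v≢w pv≡k))
          (ℤₚ.+-monoʳ-≤ 1ℤ (ℤₚ.≮⇒≥ (v-first (v≢w ∘ sym) pv≡k)))

  eligible : ∀ {k p} → Partial k p → Nonempty (unburnt k p) →
    ∃ λ w → p w ≡ k × g w ℤ.< + backDegree G p w
  eligible {k} {p} st ne with p q <? k
  ... | no pq≮k = q , ≤-antisym (Partial.bounded st q) (≮⇒≥ pq≮k) , subst (ℤ._< _) (sym gq≡-1) -<+
    where
    gq≡-1 : g q ≡ -1ℤ
    gq≡-1 = proj₁ (proj₂ g-parking)
  ... | yes pq<k with proj₂ (proj₂ g-parking) (unburnt k p) ne (<⇒≱ pq<k ∘ ∈-unburnt⁻)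
  ...   | w , w∈ , _ , gw<dOut = w , pw≡k , subst (λ d → g w ℤ.< + d) (dOut-unburnt pw≡k) gw<dOut
    where
    pw≡k : p w ≡ k
    pw≡k = ≤-antisym (Partial.bounded st w) (∈-unburnt⁻ w∈)

  -- v is given priority, so that it burns with exactly g v + 1 burnt neighbours.
  next : ∀ {k p} → Partial k p → Nonempty (unburnt k p) →
    ∃ λ w → p w ≡ k × g w ℤ.< + backDegree G p w ×
            (w ≢ v → p v ≡ k → ¬ g v ℤ.< + backDegree G p v)
  next {k} {p} st ne with (p v ≟ℕ k) ×-dec (g v ℤₚ.<? + backDegree G p v)
  ... | yes (pv≡k , v-fits) = v , pv≡k , v-fits , λ v≢v → ⊥-elim (v≢v refl)
  ... | no v-ineligible with eligible st ne
  ...   | w , pw≡k , w-fits = w , pw≡k , w-fits , λ _ pv≡k v-fits → v-ineligible (pv≡k , v-fits)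

  finish : ∀ {k p} → Partial k p → (∀ u → p u < k) →
    BurningOrder G q g p × + backDegree G p v ≡ ℤ.suc (g v)
  finish st all-burnt = record
    { injective = λ {u} → injective (all-burnt u) ; root = root ; fits = λ w → fits (all-burnt w) }
    , target-burnt (all-burnt v)
    where open Partial st

  burn : ∀ fuel {k p} → Partial k p → ∣ unburnt k p ∣ < fuel →
    ∃ λ p → BurningOrder G q g p × + backDegree G p v ≡ ℤ.suc (g v)
  burn (suc fuel) {k} {p} st size<fuel with nonempty? (unburnt k p)
  ... | no empty = p , finish st λ u → ≰⇒> λ k≤pu → empty (u , ∈-unburnt⁺ k≤pu)
  ... | yes ne with next st ne
  ...   | w , pw≡k , w-fits , v-first =
    burn fuel (Step.partial′ st pw≡k w-fits v-first)
         (<-≤-trans (p⊂q⇒∣p∣<∣q∣ (Step.unburnt-shrinks st pw≡k w-fits v-first))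
                    (s≤s⁻¹ size<fuel))

  burningOrder : ∃ λ p → BurningOrder G q g p × + backDegree G p v ≡ ℤ.suc (g v)
  burningOrder = burn (suc n) start (s≤s (∣p∣≤n (unburnt 0 (λ _ → 0))))

burningOrder-exists : ∀ {n} (G : Graph n) (q : Fin n) g → IsParking G q g → ∀ v →
  ∃ λ p → BurningOrder G q g p × + backDegree G p v ≡ ℤ.suc (g v)
burningOrder-exists G q g g-parking v = Burning.burningOrder G q g g-parking v

module _ {n} (G : Graph n) (q : Fin n) where
  open BurningOrder

  burningOrder⇒parking : ∀ {g p} → IsParking G q g → BurningOrder G q g p →
    IsParking G q (inducedParking G p)
  burningOrder⇒parking {g} {p} g-parking order =
    inducedParking-isParking G {q} {p} (root order) λ w w≢q →
      ℤₚ.drop‿+<+ (ℤₚ.≤-<-trans (parking-nonneg G q g g-parking w≢q) (fits order w))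

  burningOrder⇒maximum : ∀ {g p} → IsParking G q g → BurningOrder G q g p →
    IsMaximumParking G q (inducedParking G p)
  burningOrder⇒maximum {p = p} g-parking order =
    burningOrder⇒parking g-parking order , λ h h-parking →
      let (τ , τ-order , _) = burningOrder-exists G q h h-parking q in begin
        total h                         ≤⟨ total-mono (≼-inducedParking G {τ} {h} (fits τ-order)) ⟩
        total (inducedParking G τ)      ≡⟨ total-pred (backDegree G τ) ⟩
        + sum (backDegree G τ) ℤ.- + n  ≡⟨ cong (λ s → + s ℤ.- + n)
                                             (∑backDegree-invariant G (injective τ-order) (injective order)) ⟩
        + sum (backDegree G p) ℤ.- + n  ≡⟨ total-pred (backDegree G p) ⟨
        total (inducedParking G p)      ∎
    where open ℤₚ.≤-Reasoning

mainTheorem9 : ∀ {n : ℕ} (G : Graph n) → Connected G → (q : Fin n) →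
    (g : Fin n → ℤ) → IsParking G q g → ¬ IsMaximumParking G q g →
    ∀ (v : Fin n) → IsMinOverF G q g v (g v)
mainTheorem9 G _ q g g-parking _ v with burningOrder-exists G q g g-parking v
... | p , order , back-v≡suc-g-v =
  (inducedParking G p , (burningOrder⇒maximum G q g-parking order , ≼-inducedParking G {p} (fits order)) ,
   trans (cong pred back-v≡suc-g-v) (ℤₚ.pred-suc (g v))) ,
  λ f (_ , g≼f) → g≼f v
  where open BurningOrder
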